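{- For every $k$-ary ordering constraint function $\Pi:\mathsf{S}_k\to\{0,1\}$, every $\boldsymbol{\pi}\in\textsf{supp}(\Pi)$, all parameters $q,n,T\in\mathbb{N}$, $\alpha>0$, and every instance $\Psi$ in the support of $\mathcal{G}^{Y,\boldsymbol{\pi}}_{q,n,\alpha,T}(\Pi)$, we have $\textsf{val}_\Psi\ge 1-\frac{k-1}{q}$ (i.e., this holds with probability $1$ over $\Psi\sim\mathcal{G}^{Y,\boldsymbol{\pi}}_{q,n,\alpha,T}(\Pi)$).
   Context: Notation: $[n]=\{0,\ldots,n-1\}$, $\mathsf{S}_n$ the bijections of $[n]$; for distinct integers, $\textsf{ord}(a_0,\ldots,a_{k-1})$ is the unique $\boldsymbol{\tau}\in\mathsf{S}_k$ with $a_{\boldsymbol{\tau}(0)}<\cdots<a_{\boldsymbol{\tau}(k-1)}$. $\textsf{supp}(\Pi)=\{\boldsymbol{\pi}:\Pi(\boldsymbol{\pi})=1\}$. An instance $\Psi$ of $\textsf{Max-OCSP}(\Pi)$ on $n$ variables is a list of constraints, each a $k$-tuple $\mathbf{j}=(j_0,\ldots,j_{k-1})$ of distinct elements of $[n]$; $\boldsymbol{\sigma}\in\mathsf{S}_n$ satisfies $\mathbf{j}$ if $\Pi(\textsf{ord}(\boldsymbol{\sigma}(j_0),\ldots,\boldsymbol{\sigma}(j_{k-1})))=1$; $\textsf{val}_\Psi$ is the maximum over $\boldsymbol{\sigma}$ of the fraction of satisfied constraints. A $k$-hyperedge on $[n]$ is a $k$-tuple of distinct vertices; a $k$-hypermatching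 is a collection of $k$-hyperedges no two of which share a vertex; $\mathcal{H}_{k,n,\alpha}$ is the uniform distribution over $k$-hypermatchings on $[n]$ with $\alpha n$ hyperedges. Addition in $[q]$ is mod $q$. Let $\mathbf{v}^{(\ell)}_q=(\ell,\ell+1,\ldots,\ell+k-1)\in[q]^k$ (mod $q$), and for a $k$-tuple $\mathbf{a}$ let $\mathbf{a}_{\boldsymbol{\pi}}=(a_{\boldsymbol{\pi}^{ -1}(0)},\ldots,a_{\boldsymbol{\pi}^{ -1}(k-1)})$; for $\mathbf{b}\in[q]^n$, $\mathbf{b}|_{\mathbf{j}}=(b_{j_0},\ldots,b_{j_{k-1}})$. The distribution $\mathcal{G}^{Y,\boldsymbol{\pi}}_{q,n,\alpha,T}(\Pi)$ (resp. $\mathcal{G}^N_{q,n,\alpha,T}(\Pi)$) on instances is sampled as follows: sample uniform $\mathbf{b}\in[q]^n$; sample independent $\tilde G_0,\ldots,\tilde G_{T-1}\sim\mathcal{H}_{k,n,\alpha}$; for each $t$ and each hyperedge $\mathbf{j}$ of $\tilde G_t$, in the YES case add $\mathbf{j}$ as a constraint with probability $1/q$ if $\mathbf{b}|_{\mathbf{j}}=(\mathbf{v}^{(\ell)}_q)_{\boldsymbol{\pi}}$ for some $\ell\in[q]$ (and not otherwise); in the NO case add $\mathbf{j}$ with probability $1/q^k$ (independently); the instance consists of all added constraints. -}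

module Defs where

open import Data.Nat using (ℕ; _+_; _*_; _∸_; _≤_; NonZero)
open import Data.Nat.DivMod using (_%_)
open import Data.Fin using (Fin; toℕ; _<_)
open import Data.Vec using (Vec; lookup)
open import Data.List using (List; length; concat)
open import Data.List.Relation.Unary.All using (All)
open import Data.List.Relation.Unary.AllPairs using (AllPairs)
open import Data.List.Relation.Binary.Sublist.Propositional using (_⊆_)
open import Data.Bool using (Bool; true)
open import Data.Product using (Σ; ∃; _×_)
open import Data.Rational using (ℚ; 0ℚ) renaming (_<_ to _<ℚ_; _*_ to _*ℚ_)
open import Data.Rational using () renaming (_/_ to _/ℚ_)
open import Function.Definitions using (Injective)
open import Relation.Binary.PropositionalEquality using (_≡_; _≢_)

-- S_k : bijections of [k] = Fin k, stored as the vector of images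
-- (σ(0),…,σ(k-1)); injectivity (⇔ bijectivity on Fin k) is an irrelevant
-- field so that functions on permutations only see the underlying map.
record Perm (k : ℕ) : Set where
  constructor perm
  field
    images : Vec (Fin k) k
    .injective : Injective _≡_ _≡_ (lookup images)

app : ∀ {k} → Perm k → Fin k → Fin k
app σ i = lookup (Perm.images σ) i

OCF : ℕ → Set
OCF k = Perm k → Bool

supp : ∀ {k} → OCF k → Perm k → Set
supp Π π = Π π ≡ true

Tuple : ℕ → ℕ → Set
Tuple k n = Vec (Fin n) k

Distinct : ∀ {k n} → Tuple k n → Set
Distinct {k} j = Injective _≡_ _≡_ (lookup j)

IsOrd : ∀ {k n} → (Fin k → Fin n) → Perm k → Set
IsOrd {k} a τ = ∀ (i i' : Fin k) → i < i' → a (app τ i) < a (app τ i')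

Satisfies : ∀ {k n} → OCF k → Perm n → Tuple k n → Set
Satisfies {k} Π σ j =
  Σ (Perm k) (λ τ → IsOrd (λ i → app σ (lookup j i)) τ × Π τ ≡ true)

Instance : ℕ → ℕ → Set
Instance k n = List (Tuple k n)

-- val_Ψ ≥ 1 - c/q  (c, q naturals, q ≥ 1), with denominators cleared:
-- some σ satisfies a sub-collection S of Ψ with q·|S| ≥ (q - c)·|Ψ|,
-- i.e. q·|S| + c·|Ψ| ≥ q·|Ψ|.
ValAtLeast1-over : ∀ {k n} → OCF k → Instance k n → (c q : ℕ) → Set
ValAtLeast1-over Π Ψ c q =
  ∃ λ σ → ∃ λ S → (S ⊆ Ψ) × All (Satisfies Π σ) S
        × (q * length Ψ ≤ q * length S + c * length Ψ)

Disjoint : ∀ {k n} → Tuple k n → Tuple k n → Set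
Disjoint e f = ∀ i i' → lookup e i ≢ lookup f i'

IsHypermatching : ∀ {k n} → List (Tuple k n) → Set
IsHypermatching G = All Distinct G × AllPairs Disjoint G

Hypermatching : ℕ → ℕ → ℕ → Set
Hypermatching k n m = Σ (List (Tuple k n)) (λ G → IsHypermatching G × length G ≡ m)

-- YES-condition: b|_j = (v^{(ℓ)}_q)_π for some ℓ ∈ [q].
-- Since (a_π)_{π(i)} = a_i, this says b_{j_{π(i)}} = ℓ + i (mod q) for all i.
YesPlanted : ∀ {k n} q .{{_ : NonZero q}} → Perm k → (Fin n → Fin q) → Tuple k n → Set
YesPlanted {k} q π b j =
  Σ (Fin q) λ ℓ → ∀ (i : Fin k) → toℕ (b (lookup j (app π i))) ≡ (toℕ ℓ + toℕ i) % q

-- Support of G^{Y,π}_{q,n,α,T}(Π): there are b ∈ [q]^n and hypermatchings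
-- G_0,…,G_{T-1} with m = αn hyperedges each such that Ψ consists of some of the
-- hyperedges (with multiplicity across the G_t) each meeting the YES-condition
-- (those are added with probability 1/q > 0, the others with probability 0).
InYesSupport : ∀ {k} q .{{_ : NonZero q}} (n m T : ℕ) → Perm k → Instance k n → Set
InYesSupport {k} q n m T π Ψ =
  Σ (Fin n → Fin q) λ b →
  Σ (Vec (Hypermatching k n m) T) λ Gs →
    (Ψ ⊆ concat (Data.Vec.toList (Data.Vec.map Σ.proj₁ Gs)))
    × All (YesPlanted q π b) Ψ
  where open Data.Product using (Σ)

module Submission where

-- Shift the planted colours b by s and order the variables by colour (b + s) mod q, breaking ties by
-- index. A planted constraint with offset ℓ has colours ℓ+s, …, ℓ+s+k-1 (mod q) along π; unless these
-- wrap around q they increase along π, so the constraint is satisfied. Exactly q - (k-1) of the q shifts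
-- avoid the wrap-around for any given constraint, hence over all shifts the satisfied constraints sum
-- to at least |Ψ|(q - (k-1)), and the best shift satisfies at least a (1 - (k-1)/q)-fraction of Ψ.

open import Defs
open import Data.Nat using (ℕ; _∸_; NonZero)

module _ where
  open import Algebra.Properties.CommutativeSemigroup as CommSemigroup using ()
  open import Data.Nat using (zero; suc; _+_; _*_; _≤_; _<_; _⊓_; z≤n; s≤s; _<ᵇ_)
  open import Data.Nat.Properties
  open import Data.Nat.DivMod using (_%_; %-distribˡ-+; m%n%n≡m%n; m<n⇒m%n≡m; n%n≡0)
  open import Data.Bool.Properties using (T-≡)
  open import Data.Fin as Fin using (Fin; toℕ; fromℕ<)
  open import Data.Fin.Properties using (toℕ-injective; toℕ<n; toℕ-fromℕ<)
  open import Data.Fin.Subset using (Subset; _∈_; _∉_; _⊂_; ∣_∣)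
  open import Data.Fin.Subset.Properties using (p⊂q⇒∣p∣<∣q∣; ⊆⊤; ∈⊤; ∣⊤∣≡n)
  open import Data.Vec using (tabulate; lookup)
  open import Data.Vec.Properties using (lookup∘tabulate; []=⇒lookup; lookup⇒[]=)
  open import Data.List using ([]; _∷_; length)
  open import Data.List.Relation.Unary.All using (All; []; _∷_)
  open import Data.List.Relation.Binary.Sublist.Propositional using (_⊆_; []; _∷_; _∷ʳ_)
  open import Data.Product using (Σ; ∃; _×_; _,_; proj₁; proj₂)
  open import Function using (_∘_; Injective; Equivalence)
  open import Relation.Binary using (tri<; tri≈; tri>)
  open import Relation.Binary.PropositionalEquality
  open import Relation.Nullary using (Dec; yes; no; contradiction)

  open CommSemigroup +-commutativeSemigroup using (interchange; xy∙z≈xz∙y)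

  [m%d+n]%d≡[m+n]%d : ∀ m n d .{{_ : NonZero d}} → (m % d + n) % d ≡ (m + n) % d
  [m%d+n]%d≡[m+n]%d m n d = begin
    (m % d + n) % d             ≡⟨ %-distribˡ-+ (m % d) n d ⟩
    (m % d % d + n % d) % d     ≡⟨ cong (λ x → (x + n % d) % d) (m%n%n≡m%n m d) ⟩
    (m % d + n % d) % d         ≡⟨ %-distribˡ-+ m n d ⟨
    (m + n) % d                 ∎
    where open ≡-Reasoning

  [m+n%d]%d≡[m+n]%d : ∀ m n d .{{_ : NonZero d}} → (m + n % d) % d ≡ (m + n) % d
  [m+n%d]%d≡[m+n]%d m n d = begin
    (m + n % d) % d   ≡⟨ cong (_% d) (+-comm m (n % d)) ⟩
    (n % d + m) % d   ≡⟨ [m%d+n]%d≡[m+n]%d n m d ⟩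
    (n + m) % d       ≡⟨ cong (_% d) (+-comm n m) ⟩
    (m + n) % d       ∎
    where open ≡-Reasoning

  m<o∸n⇒m+n<o : ∀ {m n o} → m < o ∸ n → m + n < o
  m<o∸n⇒m+n<o {m} {n} {o} m<o∸n =
    m≤o∸n⇒m+n≤o (suc m) (<⇒≤ (m∸n≢0⇒n<m (m<n⇒n≢0 m<o∸n))) m<o∸n

  sumBelow : ℕ → (ℕ → ℕ) → ℕ
  sumBelow zero    f = 0
  sumBelow (suc n) f = sumBelow n f + f n

  syntax sumBelow n (λ s → e) = ∑[ s < n ] e

  sumBelow-cong : ∀ n {f g : ℕ → ℕ} → (∀ {s} → s < n → f s ≡ g s) →
                  ∑[ s < n ] f s ≡ ∑[ s < n ] g s
  sumBelow-cong zero    f≗g = refl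
  sumBelow-cong (suc n) f≗g = cong₂ _+_ (sumBelow-cong n (f≗g ∘ m<n⇒m<1+n)) (f≗g (n<1+n n))

  sumBelow-zero : ∀ n → ∑[ s < n ] 0 ≡ 0
  sumBelow-zero zero    = refl
  sumBelow-zero (suc n) = trans (+-identityʳ _) (sumBelow-zero n)

  sumBelow-distrib-+ : ∀ n (f g : ℕ → ℕ) →
                       ∑[ s < n ] (f s + g s) ≡ ∑[ s < n ] f s + ∑[ s < n ] g s
  sumBelow-distrib-+ zero    f g = refl
  sumBelow-distrib-+ (suc n) f g =
    trans (cong (_+ (f n + g n)) (sumBelow-distrib-+ n f g)) (interchange (∑[ s < n ] f s) (∑[ s < n ] g s) (f n) (g n))

  sumBelow-suc : ∀ n (f : ℕ → ℕ) → ∑[ s < suc n ] f s ≡ f 0 + ∑[ s < n ] f (suc s)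
  sumBelow-suc zero    f = sym (+-identityʳ (f 0))
  sumBelow-suc (suc n) f = trans (cong (_+ f (suc n)) (sumBelow-suc n f)) (+-assoc (f 0) _ _)

  sumBelow-rotate₁ : ∀ p (g : ℕ → ℕ) → ∑[ s < suc p ] g (suc s % suc p) ≡ ∑[ s < suc p ] g s
  sumBelow-rotate₁ p g = begin
    ∑[ s < p ] g (suc s % suc p) + g (suc p % suc p)
      ≡⟨ cong₂ _+_ (sumBelow-cong p (cong g ∘ m<n⇒m%n≡m ∘ s≤s)) (cong g (n%n≡0 (suc p))) ⟩
    ∑[ s < p ] g (suc s) + g 0  ≡⟨ +-comm _ (g 0) ⟩
    g 0 + ∑[ s < p ] g (suc s)  ≡⟨ sumBelow-suc p g ⟨
    ∑[ s < suc p ] g s          ∎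
    where open ≡-Reasoning

  sumBelow-rotate : ∀ q .{{_ : NonZero q}} L (g : ℕ → ℕ) →
                    ∑[ s < q ] g ((L + s) % q) ≡ ∑[ s < q ] g s
  sumBelow-rotate q zero g = sumBelow-cong q (cong g ∘ m<n⇒m%n≡m)
  sumBelow-rotate q@(suc p) (suc L) g = begin
    ∑[ s < q ] g ((suc L + s) % q)
      ≡⟨ sumBelow-cong q (λ {s} _ → cong g (trans (cong (_% q) (sym (+-suc L s)))
                                                 (sym ([m+n%d]%d≡[m+n]%d L (suc s) q)))) ⟩
    ∑[ s < q ] g ((L + suc s % q) % q)  ≡⟨ sumBelow-rotate₁ p (λ r → g ((L + r) % q)) ⟩
    ∑[ s < q ] g ((L + s) % q)          ≡⟨ sumBelow-rotate q L g ⟩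
    ∑[ s < q ] g s                      ∎
    where open ≡-Reasoning

  𝟙 : ∀ {p} {P : Set p} → Dec P → ℕ
  𝟙 (yes _) = 1
  𝟙 (no  _) = 0

  sumBelow-𝟙< : ∀ n m → ∑[ r < n ] 𝟙 (r <? m) ≡ n ⊓ m
  sumBelow-𝟙< zero    m = refl
  sumBelow-𝟙< (suc n) m with n <? m
  ... | yes n<m = begin
    ∑[ r < n ] 𝟙 (r <? m) + 1  ≡⟨ cong (_+ 1) (sumBelow-𝟙< n m) ⟩
    n ⊓ m + 1                  ≡⟨ cong (_+ 1) (m≤n⇒m⊓n≡m (<⇒≤ n<m)) ⟩
    n + 1                      ≡⟨ +-comm n 1 ⟩
    suc n                      ≡⟨ m≤n⇒m⊓n≡m n<m ⟨
    suc n ⊓ m                  ∎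
    where open ≡-Reasoning
  ... | no n≮m = begin
    ∑[ r < n ] 𝟙 (r <? m) + 0  ≡⟨ +-identityʳ _ ⟩
    ∑[ r < n ] 𝟙 (r <? m)      ≡⟨ sumBelow-𝟙< n m ⟩
    n ⊓ m                      ≡⟨ m≥n⇒m⊓n≡n m≤n ⟩
    m                          ≡⟨ m≥n⇒m⊓n≡n (m≤n⇒m≤1+n m≤n) ⟨
    suc n ⊓ m                  ∎
    where
    open ≡-Reasoning
    m≤n : m ≤ n
    m≤n = ≮⇒≥ n≮m

  sumBelow≤n*largest : ∀ n (f : ℕ → ℕ) → ∃ λ s → ∑[ t < n ] f t ≤ n * f s
  sumBelow≤n*largest zero    f = 0 , z≤n
  sumBelow≤n*largest (suc n) f with sumBelow≤n*largest n f
  ... | s , ∑≤n*fs with f s ≤? f n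
  ...   | yes fs≤fn = n , (begin
          ∑[ t < n ] f t + f n  ≤⟨ +-monoˡ-≤ (f n) ∑≤n*fs ⟩
          n * f s + f n         ≤⟨ +-monoˡ-≤ (f n) (*-monoʳ-≤ n fs≤fn) ⟩
          n * f n + f n         ≡⟨ +-comm (n * f n) (f n) ⟩
          suc n * f n           ∎)
    where open ≤-Reasoning
  ...   | no fs≰fn = s , (begin
          ∑[ t < n ] f t + f n  ≤⟨ +-mono-≤ ∑≤n*fs (<⇒≤ (≰⇒> fs≰fn)) ⟩
          n * f s + f s         ≡⟨ +-comm (n * f s) (f s) ⟩
          suc n * f s           ∎)
    where open ≤-Reasoning

  module Ranking {n} (key : Fin n → ℕ) (key-injective : Injective _≡_ _≡_ key) where

    below : Fin n → Subset n
    below x = tabulate λ y → key y <ᵇ key x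

    ∈-below⁻ : ∀ {x y} → y ∈ below x → key y < key x
    ∈-below⁻ {x} {y} y∈ =
      <ᵇ⇒< _ _ (Equivalence.from T-≡ (trans (sym (lookup∘tabulate _ y)) ([]=⇒lookup y∈)))

    ∈-below⁺ : ∀ {x y} → key y < key x → y ∈ below x
    ∈-below⁺ {x} {y} lt = lookup⇒[]= y _ (trans (lookup∘tabulate _ y) (Equivalence.to T-≡ (<⇒<ᵇ lt)))

    ∉-below-self : ∀ x → x ∉ below x
    ∉-below-self x = <-irrefl refl ∘ ∈-below⁻

    below-⊂ : ∀ {x y} → key x < key y → below x ⊂ below y
    below-⊂ {x} lt = (λ z∈ → ∈-below⁺ (<-trans (∈-below⁻ z∈) lt)) , x , ∈-below⁺ lt , ∉-below-self x

    ∣below∣<n : ∀ x → ∣ below x ∣ < n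
    ∣below∣<n x = subst (∣ below x ∣ <_) (∣⊤∣≡n n) (p⊂q⇒∣p∣<∣q∣ (⊆⊤ , x , ∈⊤ , ∉-below-self x))

    rank : Fin n → Fin n
    rank x = fromℕ< (∣below∣<n x)

    rank-mono : ∀ {x y} → key x < key y → rank x Fin.< rank y
    rank-mono lt = subst₂ _<_ (sym (toℕ-fromℕ< _)) (sym (toℕ-fromℕ< _)) (p⊂q⇒∣p∣<∣q∣ (below-⊂ lt))

    rank-injective : Injective _≡_ _≡_ rank
    rank-injective {x} {y} eq with <-cmp (key x) (key y)
    ... | tri< lt _ _ = contradiction (cong toℕ eq) (<⇒≢ (rank-mono lt))
    ... | tri≈ _ k≡ _ = key-injective k≡
    ... | tri> _ _ gt = contradiction (cong toℕ (sym eq)) (<⇒≢ (rank-mono gt))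

    rankPerm : Perm n
    rankPerm = perm (tabulate rank) λ {x} {y} eq →
      rank-injective (trans (sym (lookup∘tabulate rank x)) (trans eq (lookup∘tabulate rank y)))

    rankPerm-mono : ∀ {x y} → key x < key y → app rankPerm x Fin.< app rankPerm y
    rankPerm-mono {x} {y} lt =
      subst₂ Fin._<_ (sym (lookup∘tabulate rank x)) (sym (lookup∘tabulate rank y)) (rank-mono lt)

  sortingPerm : ∀ {n} (c : Fin n → ℕ) →
                Σ (Perm n) λ σ → ∀ {x y} → c x < c y → app σ x Fin.< app σ y
  sortingPerm {n} c = rankPerm , rankPerm-mono ∘ lexKey-<
    where
    lexKey : Fin n → ℕ
    lexKey x = c x * n + toℕ x

    lexKey-< : ∀ {x y} → c x < c y → lexKey x < lexKey y
    lexKey-< {x} {y} lt = begin-strict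
      c x * n + toℕ x  <⟨ +-monoʳ-< (c x * n) (toℕ<n x) ⟩
      c x * n + n      ≡⟨ +-comm (c x * n) n ⟩
      suc (c x) * n    ≤⟨ *-monoˡ-≤ n lt ⟩
      c y * n          ≤⟨ m≤m+n (c y * n) (toℕ y) ⟩
      lexKey y         ∎
      where open ≤-Reasoning

    lexKey-injective : Injective _≡_ _≡_ lexKey
    lexKey-injective {x} {y} eq with <-cmp (c x) (c y)
    ... | tri< lt _ _ = contradiction eq (<⇒≢ (lexKey-< lt))
    ... | tri≈ _ c≡ _ = toℕ-injective
      (+-cancelˡ-≡ (c x * n) _ _ (trans eq (cong (λ z → z * n + toℕ y) (sym c≡))))
    ... | tri> _ _ gt = contradiction (sym eq) (<⇒≢ (lexKey-< gt))

    open Ranking lexKey lexKey-injective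

  module PlantedShift {k n} (Π : OCF k) (π : Perm k) (π∈supp : supp Π π)
                      (q : ℕ) .{{_ : NonZero q}} (b : Fin n → Fin q) where

    d : ℕ
    d = k ∸ 1

    colour : ℕ → Fin n → ℕ
    colour s x = (toℕ (b x) + s) % q

    shiftSort : ℕ → Perm n
    shiftSort s = proj₁ (sortingPerm (colour s))

    Unwrapped : ℕ → Fin q → Set
    Unwrapped s ℓ = (toℕ ℓ + s) % q < q ∸ d

    unwrapped? : ∀ s ℓ → Dec (Unwrapped s ℓ)
    unwrapped? s ℓ = (toℕ ℓ + s) % q <? q ∸ d

    shifted-colour : ∀ ℓ i s → (ℓ + s) % q + i < q → ((ℓ + i) % q + s) % q ≡ (ℓ + s) % q + i
    shifted-colour ℓ i s fits = begin
      ((ℓ + i) % q + s) % q  ≡⟨ [m%d+n]%d≡[m+n]%d (ℓ + i) s q ⟩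
      (ℓ + i + s) % q        ≡⟨ cong (_% q) (xy∙z≈xz∙y ℓ i s) ⟩
      (ℓ + s + i) % q        ≡⟨ [m%d+n]%d≡[m+n]%d (ℓ + s) i q ⟨
      ((ℓ + s) % q + i) % q  ≡⟨ m<n⇒m%n≡m fits ⟩
      (ℓ + s) % q + i        ∎
      where open ≡-Reasoning

    unwrapped-satisfied : ∀ s {ψ} (planted : YesPlanted q π b ψ) → Unwrapped s (proj₁ planted) →
                          Satisfies Π (shiftSort s) ψ
    unwrapped-satisfied s {ψ} (ℓ , on-colours) unwrapped = π , increasing , π∈supp
      where
      r : ℕ
      r = (toℕ ℓ + s) % q

      colour-along-π : ∀ i → colour s (lookup ψ (app π i)) ≡ r + toℕ i
      colour-along-π i = trans (cong (λ c → (c + s) % q) (on-colours i))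
        (shifted-colour (toℕ ℓ) (toℕ i) s
          (≤-<-trans (+-monoʳ-≤ r (∸-monoˡ-≤ 1 (toℕ<n i))) (m<o∸n⇒m+n<o unwrapped)))

      increasing : IsOrd (λ i → app (shiftSort s) (lookup ψ i)) π
      increasing i i' i<i' = proj₂ (sortingPerm (colour s))
        (subst₂ _<_ (sym (colour-along-π i)) (sym (colour-along-π i')) (+-monoʳ-< r i<i'))

    unwrappedCount : ∀ {Ψ} → ℕ → All (YesPlanted q π b) Ψ → ℕ
    unwrappedCount s []             = 0
    unwrappedCount s ((ℓ , _) ∷ ps) = 𝟙 (unwrapped? s ℓ) + unwrappedCount s ps

    satisfiedSublist : ∀ s {Ψ} (ps : All (YesPlanted q π b) Ψ) →
      ∃ λ S → S ⊆ Ψ × All (Satisfies Π (shiftSort s)) S × unwrappedCount s ps ≤ length S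
    satisfiedSublist s [] = [] , [] , [] , z≤n
    satisfiedSublist s {ψ ∷ _} (p@(ℓ , _) ∷ ps) with unwrapped? s ℓ | satisfiedSublist s ps
    ... | yes u | S , S⊆Ψ , sat , count≤ = ψ ∷ S , refl ∷ S⊆Ψ , unwrapped-satisfied s {ψ} p u ∷ sat , s≤s count≤
    ... | no _  | S , S⊆Ψ , sat , count≤ = S , ψ ∷ʳ S⊆Ψ , sat , count≤

    unwrapped-shifts : ∀ ℓ → ∑[ s < q ] 𝟙 (unwrapped? s ℓ) ≡ q ∸ d
    unwrapped-shifts ℓ = begin
      ∑[ s < q ] 𝟙 (unwrapped? s ℓ)  ≡⟨ sumBelow-rotate q (toℕ ℓ) (λ r → 𝟙 (r <? q ∸ d)) ⟩
      ∑[ r < q ] 𝟙 (r <? q ∸ d)      ≡⟨ sumBelow-𝟙< q (q ∸ d) ⟩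
      q ⊓ (q ∸ d)                    ≡⟨ m≥n⇒m⊓n≡n (m∸n≤m q d) ⟩
      q ∸ d                          ∎
      where open ≡-Reasoning

    sumBelow-unwrappedCount : ∀ {Ψ} (ps : All (YesPlanted q π b) Ψ) →
                              ∑[ s < q ] unwrappedCount s ps ≡ length Ψ * (q ∸ d)
    sumBelow-unwrappedCount [] = sumBelow-zero q
    sumBelow-unwrappedCount ((ℓ , _) ∷ ps) =
      trans (sumBelow-distrib-+ q _ _) (cong₂ _+_ (unwrapped-shifts ℓ) (sumBelow-unwrappedCount ps))

    bestShift-val : ∀ {Ψ} → All (YesPlanted q π b) Ψ → ValAtLeast1-over Π Ψ d q
    bestShift-val {Ψ} ps with sumBelow≤n*largest q (λ s → unwrappedCount s ps)
    ... | s , ∑≤q*count with satisfiedSublist s ps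
    ... | S , S⊆Ψ , sat , count≤∣S∣ = shiftSort s , S , S⊆Ψ , sat , (begin
      q * L                                   ≤⟨ *-monoˡ-≤ L (m≤n+m∸n q d) ⟩
      (d + (q ∸ d)) * L                       ≡⟨ *-distribʳ-+ L d (q ∸ d) ⟩
      d * L + (q ∸ d) * L                     ≡⟨ cong (d * L +_) (*-comm (q ∸ d) L) ⟩
      d * L + L * (q ∸ d)                     ≡⟨ cong (d * L +_) (sumBelow-unwrappedCount ps) ⟨
      d * L + ∑[ t < q ] unwrappedCount t ps  ≤⟨ +-monoʳ-≤ (d * L) ∑≤q*count ⟩
      d * L + q * unwrappedCount s ps         ≤⟨ +-monoʳ-≤ (d * L) (*-monoʳ-≤ q count≤∣S∣) ⟩
      d * L + q * length S                    ≡⟨ +-comm (d * L) (q * length S) ⟩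
      q * length S + d * L                    ∎)
      where
      open ≤-Reasoning
      L : ℕ
      L = length Ψ

open import Data.Integer using (+_)
open import Data.Rational using (ℚ; 0ℚ; _/_; _<_; _*_)
open import Data.Product using (_,_)
open import Relation.Binary.PropositionalEquality using (_≡_)

lemma3p3 : (k : ℕ) (Π : OCF k) (π : Perm k) → supp Π π →
    (q n T : ℕ) .{{_ : NonZero q}} (α : ℚ) → 0ℚ < α →
    (m : ℕ) → (+ m / 1) ≡ α * (+ n / 1) →
    (Ψ : Instance k n) → InYesSupport q n m T π Ψ →
    ValAtLeast1-over Π Ψ (k ∸ 1) q
lemma3p3 k Π π π∈supp q n T α _ m _ Ψ (b , _ , _ , planted) =
  PlantedShift.bestShift-val Π π π∈supp q b planted
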